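{- Let $\mathcal{R}$ be a terminating term rewrite system over a finite signature $\mathcal{F}$, and define $$f(n) := \max\{\mathrm{dh}(t^\sharp, \to_{\mathrm{DP}(\mathcal{R})/\mathcal{R}}) \mid |t| \leqslant n\}.$$ Then there exists $D \in \mathbb{N}$ such that for all $n \in \mathbb{N}$, $$\mathrm{dc}_{\mathcal{R}}(n) \leqslant 2^{2^{n \cdot 2^{D\cdot(f(n)+1)}}}.$$
   Context: $\mathcal{V}$ is a countably infinite set of variables and $\mathcal{T}(\mathcal{F},\mathcal{V})$ is the set of terms. $|t|$ is the size of $t$, i.e. the number of occurrences of function symbols and variables in $t$. A TRS $\mathcal{R}$ is a finite set of rules $l \to r$ with $l \notin \mathcal{V}$ and $\mathrm{Var}(r) \subseteq \mathrm{Var}(l)$. $\to_{\mathcal{R}}$ is its rewrite relation (closed under contexts and substitutions). A symbol is defined if it is the root of the left-hand side of some rule; $\mathcal{D}$ denotes the set of defined symbols. For a relation $\to$, the derivation height is $\mathrm{dh}(s,\to) = \max\{n \mid \exists t,\ s \to^n t\}$. The derivational complexity is $\mathrm{dc}_{\mathcal{R}}(n) = \max\{\mathrm{dh}(t,\to_{\mathcal{R}}) \mid |t| \leqslant n\}$. For each $f \in \mathcal{F}$ let $f^\sharp$ be a fresh symbol of the same arity. For a term $t$, $t^\sharp = t$ if $t$ is a variable, and $t^\sharp = f^\sharp(t_1,\dots,t_n)$ if $t = f(t_1,\dots,t_n)$. The set of dependency pairs is $$\mathrm{DP}(\mathcal{R}) = \{l^\sharp \to u^\sharp \mid l \to r \in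 \mathcal{R},\ u \text{ a subterm of } r,\ \mathrm{root}(u) \in \mathcal{D},\ u \text{ not a proper subterm of } l\}.$$ For TRSs $\mathcal{P}$ and $\mathcal{S}$ (over the signature extended by the marked symbols), the relative rewrite relation is $\to_{\mathcal{P}/\mathcal{S}} = \to_{\mathcal{S}}^* \cdot \to_{\mathcal{P}} \cdot \to_{\mathcal{S}}^*$. -}

module Defs where

open import Data.Nat using (ℕ; zero; suc; _+_; _≤_)
open import Data.Fin using (Fin)
open import Data.Vec using (Vec; []; _∷_; lookup; _[_]≔_)
open import Data.List using (List)
open import Data.List.Membership.Propositional using (_∈_)
open import Data.List.Relation.Unary.All using (All)
open import Data.Product using (Σ; ∃; _×_; _,_)
open import Data.Sum using (_⊎_; inj₁; inj₂; [_,_])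
open import Relation.Nullary using (¬_)
open import Relation.Binary.PropositionalEquality using (_≡_)
open import Relation.Binary.Construct.Closure.ReflexiveTransitive using (Star)
open import Induction.WellFounded using (WellFounded)

data Term {S : Set} (ar : S → ℕ) : Set where
  var : ℕ → Term ar
  fun : (f : S) → Vec (Term ar) (ar f) → Term ar

module _ {S : Set} {ar : S → ℕ} where

  mutual
    size : Term ar → ℕ
    size (var x)    = 1
    size (fun f ts) = suc (sizes ts)

    sizes : ∀ {n} → Vec (Term ar) n → ℕ
    sizes []       = 0
    sizes (t ∷ ts) = size t + sizes ts

  Subst : Set
  Subst = ℕ → Term ar

  mutual
    _⟪_⟫ : Term ar → Subst → Term ar
    var x    ⟪ σ ⟫ = σ x
    fun f ts ⟪ σ ⟫ = fun f (substs ts σ)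

    substs : ∀ {n} → Vec (Term ar) n → Subst → Vec (Term ar) n
    substs []       σ = []
    substs (t ∷ ts) σ = (t ⟪ σ ⟫) ∷ substs ts σ

  data Occurs (x : ℕ) : Term ar → Set where
    here : Occurs x (var x)
    arg  : ∀ {f} {ts : Vec (Term ar) (ar f)} (i : Fin (ar f)) →
           Occurs x (lookup ts i) → Occurs x (fun f ts)

  data _⊴_ (s : Term ar) : Term ar → Set where
    refl : s ⊴ s
    arg  : ∀ {f} {ts : Vec (Term ar) (ar f)} (i : Fin (ar f)) →
           s ⊴ lookup ts i → s ⊴ fun f ts

  data _◁_ (s : Term ar) : Term ar → Set where
    arg : ∀ {f} {ts : Vec (Term ar) (ar f)} (i : Fin (ar f)) →
          s ⊴ lookup ts i → s ◁ fun f ts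

  data RootIs (g : S) : Term ar → Set where
    root : (ts : Vec (Term ar) (ar g)) → RootIs g (fun g ts)

  IsFun : Term ar → Set
  IsFun t = ∃ λ g → RootIs g t

  Rule : Set
  Rule = Term ar × Term ar

  WellFormedRule : Rule → Set
  WellFormedRule (l , r) = IsFun l × (∀ x → Occurs x r → Occurs x l)

  IsTRS : List Rule → Set
  IsTRS R = All WellFormedRule R

  data Step (P : Rule → Set) : Term ar → Term ar → Set where
    root : ∀ {l r} → P (l , r) → (σ : Subst) → Step P (l ⟪ σ ⟫) (r ⟪ σ ⟫)
    arg  : ∀ {f} (ts : Vec (Term ar) (ar f)) (i : Fin (ar f)) {t} →
           Step P (lookup ts i) t → Step P (fun f ts) (fun f (ts [ i ]≔ t))

  _∈R : List Rule → Rule → Set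
  (R ∈R) ρ = ρ ∈ R

  Defined : List Rule → S → Set
  Defined R g = Σ Rule λ { (l , r) → (l , r) ∈ R × RootIs g l }

  Terminating : List Rule → Set
  Terminating R = WellFounded (λ t s → Step (R ∈R) s t)

module _ {A : Set} where

  data Iter (_⟶_ : A → A → Set) : ℕ → A → A → Set where
    done : ∀ {s} → Iter _⟶_ 0 s s
    next : ∀ {n s u t} → s ⟶ u → Iter _⟶_ n u t → Iter _⟶_ (suc n) s t

  -- dh(s, ⟶) ≤ m : every derivation from s has length ≤ m
  DhLe : (A → A → Set) → A → ℕ → Set
  DhLe _⟶_ s m = ∀ k t → Iter _⟶_ k s t → k ≤ m

  Relative : (A → A → Set) → (A → A → Set) → A → A → Set
  Relative _⟶P_ _⟶S_ s t =
    Σ A λ u → Σ A λ v → Star _⟶S_ s u × u ⟶P v × Star _⟶S_ v t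

-- Marked signature F ∪ F♯ : inj₁ f = f, inj₂ f = f♯

module _ {S : Set} (ar : S → ℕ) where

  ar♯ : S ⊎ S → ℕ
  ar♯ = [ ar , ar ]

module _ {S : Set} {ar : S → ℕ} where

  mutual
    emb : Term ar → Term (ar♯ ar)
    emb (var x)    = var x
    emb (fun f ts) = fun (inj₁ f) (embs ts)

    embs : ∀ {n} → Vec (Term ar) n → Vec (Term (ar♯ ar)) n
    embs []       = []
    embs (t ∷ ts) = emb t ∷ embs ts

  mark : Term ar → Term (ar♯ ar)
  mark (var x)    = var x
  mark (fun f ts) = fun (inj₂ f) (embs ts)

  data Emb (R : List (Rule {ar = ar})) : Rule {ar = ar♯ ar} → Set where
    emb-rule : ∀ {l r} → (l , r) ∈ R → Emb R (emb l , emb r)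

  data DP (R : List (Rule {ar = ar})) : Rule {ar = ar♯ ar} → Set where
    dp : ∀ {l r u g} → (l , r) ∈ R → u ⊴ r → RootIs g u → Defined R g →
         ¬ (u ◁ l) → DP R (mark l , mark u)

  DP/R : List (Rule {ar = ar}) → Term (ar♯ ar) → Term (ar♯ ar) → Set
  DP/R R = Relative (Step (DP R)) (Step (Emb R))

module Submission where

-- Proof idea: an interpretation argument.  Fix n, m such that every t♯ with
-- |t| ≤ n has DP(R)/R-height at most m, and give terms natural-number
-- *weights*: a variable may weigh anything; a node f(ts) whose arguments weigh
-- x in total weighs more than x if f is a constructor, and at least B j x if f
-- is defined and f(ts)♯ has DP(R)/R-height at most j.  The hierarchy
-- B j x = 1 + ψ^d(x), with ψ built from B (j-1), makes every R-step decrease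
-- weights: for a root step l → r the contractum rσ is weighed node by node,
-- and each defined node of r outside l is reached by a DP(R)/R-step, so has
-- height at most j-1.  Hence weights bound derivation heights.  Each B j raises the level a of 2^2^a by a
-- constant exponential in j, which bounds the initial weight of a term of
-- size ≤ n by 2^2^(n·2^(D·(m+1))).

open import Defs
open import Data.Nat using (ℕ; zero; suc; _+_; _*_; _^_; _≤_; _<_; _⊔_; z≤n; s≤s; NonZero; >-nonZero)
open import Data.Nat.Properties
open import Data.Nat.GeneralisedArithmetic using (fold)
open import Data.Nat.Tactic.RingSolver using (solve-∀)
open import Data.Fin using (Fin; zero; suc)
import Data.Fin.Properties as Fin
open import Data.Vec using (Vec; []; _∷_; lookup; _[_]≔_; sum)
open import Data.Vec.Properties using (lookup∘update; lookup∘update′)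
open import Data.List using (List; []; _∷_)
open import Data.List.Membership.Propositional using (_∈_; find; lose)
open import Data.List.Relation.Unary.Any using (here; there; any?)
import Data.List.Relation.Unary.All as All
open import Data.Product using (Σ; ∃; _×_; _,_; proj₁; proj₂; ∃-syntax)
open import Data.Sum using (_⊎_; inj₁; inj₂)
open import Data.Empty using (⊥-elim)
open import Function using (_∘_)
open import Relation.Nullary using (¬_; Dec; yes; no)
import Relation.Nullary.Decidable as Dec
open import Relation.Binary.Definitions using (Monotonic₁)
open import Relation.Binary.PropositionalEquality
open import Relation.Binary.Construct.Closure.ReflexiveTransitive using (ε; _◅_)

DhLe-weaken : ∀ {A : Set} {_⟶_ : A → A → Set} {s a b} → DhLe _⟶_ s a → a ≤ b → DhLe _⟶_ s b
DhLe-weaken h a≤b k t it = ≤-trans (h k t it) a≤b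

DhLe-nonzero : ∀ {A : Set} {_⟶_ : A → A → Set} {s t} → s ⟶ t → ¬ DhLe _⟶_ s 0
DhLe-nonzero st h with h 1 _ (next st done)
... | ()

DhLe-step : ∀ {A : Set} {_⟶_ : A → A → Set} {s t j} → s ⟶ t → DhLe _⟶_ s (suc j) → DhLe _⟶_ t j
DhLe-step st h k u it = ≤-pred (h (suc k) u (next st it))

rank-bounds-dh : ∀ {A : Set} {_⟶_ : A → A → Set} (Rank : A → ℕ → Set) →
  (∀ {s t v} → s ⟶ t → Rank s v → ∃ λ v' → v' < v × Rank t v') →
  ∀ {s v} → Rank s v → DhLe _⟶_ s v
rank-bounds-dh Rank decrease r .0 t done = z≤n
rank-bounds-dh Rank decrease r (suc k) t (next st it) with decrease st r
... | v' , v'<v , r' = ≤-trans (s≤s (rank-bounds-dh Rank decrease r' k t it)) v'<v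

relative-single : ∀ {A : Set} {P S : A → A → Set} {s t} → P s t → Relative P S s t
relative-single p = _ , _ , ε , p , ε

-- Prefixing S-steps does not shorten relative derivations, so S-steps do
-- not increase the P/S-height.
DhLe-relative-prepend : ∀ {A : Set} {P S : A → A → Set} {s s' j} → S s s' →
  DhLe (Relative P S) s j → DhLe (Relative P S) s' j
DhLe-relative-prepend st h .0 t done = z≤n
DhLe-relative-prepend st h (suc k) t (next (u , v , s⟶u , p , v⟶w) rest) =
  h (suc k) t (next (u , v , st ◅ s⟶u , p , v⟶w) rest)

Fin-bounded : ∀ {k} (g : Fin k → ℕ) → ∃ λ b → ∀ i → g i ≤ b
Fin-bounded {zero} g = 0 , λ ()
Fin-bounded {suc k} g with Fin-bounded (g ∘ suc)
... | b , ≤b = g zero ⊔ b , λ { zero → m≤m⊔n _ _ ; (suc i) → ≤-trans (≤b i) (m≤n⊔m _ _) }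

List-bounded : ∀ {A : Set} (g : A → ℕ) (xs : List A) → ∃ λ b → ∀ {x} → x ∈ xs → g x ≤ b
List-bounded g [] = 0 , λ ()
List-bounded g (x ∷ xs) with List-bounded g xs
... | b , ≤b = g x ⊔ b , λ { (here refl) → m≤m⊔n _ _ ; (there p) → ≤-trans (≤b p) (m≤n⊔m _ _) }

n<2^n : ∀ n → n < 2 ^ n
n<2^n zero = s≤s z≤n
n<2^n (suc n) = +-mono-≤ (m^n>0 2 n) (≤-trans (n<2^n n) (m≤m+n (2 ^ n) 0))

lookup≤sum : ∀ {n} (vs : Vec ℕ n) i → lookup vs i ≤ sum vs
lookup≤sum (x ∷ vs) zero = m≤m+n x (sum vs)
lookup≤sum (x ∷ vs) (suc i) = ≤-trans (lookup≤sum vs i) (m≤n+m (sum vs) x)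

sum-update-< : ∀ {n} (vs : Vec ℕ n) i {v'} → v' < lookup vs i → sum (vs [ i ]≔ v') < sum vs
sum-update-< (x ∷ vs) zero p = +-monoˡ-< (sum vs) p
sum-update-< (x ∷ vs) (suc i) p = +-monoʳ-< x (sum-update-< vs i p)

sum-bound : ∀ {n} (vs : Vec ℕ n) {Y} → (∀ i → lookup vs i ≤ Y) → sum vs ≤ n * Y
sum-bound [] h = z≤n
sum-bound (x ∷ vs) h = +-mono-≤ (h zero) (sum-bound vs (h ∘ suc))

Inflationary : (ℕ → ℕ) → Set
Inflationary f = ∀ x → x ≤ f x

fold-mono : ∀ n {f} → Monotonic₁ _≤_ _≤_ f → Monotonic₁ _≤_ _≤_ (λ x → fold x f n)
fold-mono zero mono p = p
fold-mono (suc n) mono p = mono (fold-mono n mono p)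

fold-smono : ∀ n {f} → Monotonic₁ _<_ _<_ f → Monotonic₁ _<_ _<_ (λ x → fold x f n)
fold-smono zero mono p = p
fold-smono (suc n) mono p = mono (fold-smono n mono p)

fold-infl : ∀ n {f} → Inflationary f → Inflationary (λ x → fold x f n)
fold-infl zero infl x = ≤-refl
fold-infl (suc n) {f} infl x = ≤-trans (fold-infl n infl x) (infl (fold x f n))

fold-more : ∀ {f} → Monotonic₁ _≤_ _≤_ f → Inflationary f → ∀ x {n n'} → n ≤ n' → fold x f n ≤ fold x f n'
fold-more mono infl x {zero} {n'} z≤n = fold-infl n' infl x
fold-more mono infl x (s≤s n≤n') = mono (fold-more mono infl x n≤n')

Φ : ℕ → ℕ
Φ a = 2 ^ (2 ^ a)

Φ-mono : ∀ {a b} → a ≤ b → Φ a ≤ Φ b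
Φ-mono p = ^-monoʳ-≤ 2 (^-monoʳ-≤ 2 p)

Φ-suc : ∀ a → Φ (suc a) ≡ Φ a * Φ a
Φ-suc a = trans (cong (2 ^_) (cong (2 ^ a +_) (+-identityʳ (2 ^ a)))) (^-distribˡ-+-* 2 (2 ^ a) (2 ^ a))

1<Φ : ∀ a → 1 < Φ a
1<Φ a = ^-monoʳ-≤ 2 (m^n>0 2 a)

Φ-+ : ∀ a {x y} → x ≤ Φ a → y ≤ Φ a → x + y ≤ Φ (suc a)
Φ-+ a {x} {y} p q = begin
  x + y         ≤⟨ +-mono-≤ p q ⟩
  Φ a + Φ a     ≡⟨ cong (Φ a +_) (sym (+-identityʳ (Φ a))) ⟩
  2 * Φ a       ≤⟨ *-monoˡ-≤ (Φ a) (1<Φ a) ⟩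
  Φ a * Φ a     ≡⟨ sym (Φ-suc a) ⟩
  Φ (suc a)     ∎
  where open ≤-Reasoning

Φ-suc-≤ : ∀ a {x} → x ≤ Φ a → suc x ≤ Φ (suc a)
Φ-suc-≤ a = Φ-+ a (<⇒≤ (1<Φ a))

Φ-2^ : ∀ j a {x} → x ≤ Φ a → 2 ^ j * x ≤ Φ (a + j)
Φ-2^ zero a {x} p = subst₂ _≤_ (sym (+-identityʳ x)) (cong Φ (sym (+-identityʳ a))) p
Φ-2^ (suc j) a {x} p = begin
  2 ^ suc j * x               ≡⟨ *-assoc 2 (2 ^ j) x ⟩
  2 * (2 ^ j * x)             ≡⟨ cong (2 ^ j * x +_) (+-identityʳ (2 ^ j * x)) ⟩
  2 ^ j * x + 2 ^ j * x       ≤⟨ Φ-+ (a + j) (Φ-2^ j a p) (Φ-2^ j a p) ⟩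
  Φ (suc (a + j))             ≡⟨ cong Φ (sym (+-suc a j)) ⟩
  Φ (a + suc j)               ∎
  where open ≤-Reasoning

Lifts : (ℕ → ℕ) → ℕ → Set
Lifts G c = ∀ a {x} → x ≤ Φ a → G x ≤ Φ (a + c)

Lifts-fold : ∀ {f c} → Lifts f c → ∀ n → Lifts (λ x → fold x f n) (n * c)
Lifts-fold lifts zero a {x} p = subst (λ b → x ≤ Φ b) (sym (+-identityʳ a)) p
Lifts-fold {f} {c} lifts (suc n) a {x} p =
  subst (λ b → fold x f (suc n) ≤ Φ b) (reassoc a n c) (lifts (a + n * c) (Lifts-fold lifts n a p))
  where
  reassoc : ∀ a n c → a + n * c + c ≡ a + (c + n * c)
  reassoc = solve-∀

-- The hierarchy of weight bounds, for symbols of arity and right-hand sides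
-- of size at most d = 2^e.  ψ G y bounds the weight of a node whose arguments
-- weigh at most y each and which itself costs G applied to their sum;
-- B j x = 1 + ψ^d(x) with the nodes costing B (j - 1) ("below j").
module Hierarchy (e : ℕ) where

  d : ℕ
  d = 2 ^ e

  instance
    d-nonZero : NonZero d
    d-nonZero = >-nonZero (m^n>0 2 e)

  ψ : (ℕ → ℕ) → ℕ → ℕ
  ψ G y = suc (G (d * y) + d * y)

  step : (ℕ → ℕ) → ℕ → ℕ
  step G x = suc (fold x (ψ G) d)

  mutual
    B : ℕ → ℕ → ℕ
    B j = step (below j)

    below : ℕ → ℕ → ℕ
    below zero _ = 0
    below (suc j) = B j

  ψ-mono : ∀ {G} → Monotonic₁ _≤_ _≤_ G → Monotonic₁ _≤_ _≤_ (ψ G)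
  ψ-mono mono p = s≤s (+-mono-≤ (mono (*-monoʳ-≤ d p)) (*-monoʳ-≤ d p))

  ψ-smono : ∀ {G} → Monotonic₁ _≤_ _≤_ G → Monotonic₁ _<_ _<_ (ψ G)
  ψ-smono mono p = s≤s (+-mono-≤-< (mono (*-monoʳ-≤ d (<⇒≤ p))) (*-monoʳ-< d p))

  ψ-infl : ∀ G → Inflationary (ψ G)
  ψ-infl G y = ≤-trans (m≤n*m y d) (≤-trans (m≤n+m (d * y) (G (d * y))) (n≤1+n _))

  step-infl : ∀ G x → x < step G x
  step-infl G x = s≤s (fold-infl d (ψ-infl G) x)

  mutual
    B-mono : ∀ j → Monotonic₁ _≤_ _≤_ (B j)
    B-mono j p = s≤s (fold-mono d (ψ-mono (below-mono j)) p)

    below-mono : ∀ j → Monotonic₁ _≤_ _≤_ (below j)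
    below-mono zero _ = z≤n
    below-mono (suc j) = B-mono j

  B-smono : ∀ j → Monotonic₁ _<_ _<_ (B j)
  B-smono j p = s≤s (fold-smono d (ψ-smono (below-mono j)) p)

  Lifts-ψ : ∀ {G c} → Lifts G c → Lifts (ψ G) (e + c + 2)
  Lifts-ψ {G} {c} lifts a {x} p = subst (λ b → ψ G x ≤ Φ b) (reassoc a e c) ψx≤
    where
    dx≤ : d * x ≤ Φ (a + e)
    dx≤ = Φ-2^ e a p
    ψx≤ : ψ G x ≤ Φ (suc (suc (a + e + c)))
    ψx≤ = Φ-suc-≤ (suc (a + e + c)) (Φ-+ (a + e + c) (lifts (a + e) dx≤) (≤-trans dx≤ (Φ-mono (m≤m+n (a + e) c))))
    reassoc : ∀ a e c → suc (suc (a + e + c)) ≡ a + (e + c + 2)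
    reassoc = solve-∀

  Lifts-step : ∀ {G c} → Lifts G c → Lifts (step G) (d * (e + c + 2) + 1)
  Lifts-step {G} {c} lifts a {x} p =
    subst (λ b → step G x ≤ Φ b) (trans (sym (+-suc a _)) (cong (a +_) (+-comm 1 _)))
      (Φ-suc-≤ (a + d * (e + c + 2)) (Lifts-fold (Lifts-ψ lifts) d a p))

  mutual
    lift : ℕ → ℕ
    lift j = d * (e + lift-below j + 2) + 1

    lift-below : ℕ → ℕ
    lift-below zero = 0
    lift-below (suc j) = lift j

  mutual
    Lifts-B : ∀ j → Lifts (B j) (lift j)
    Lifts-B j = Lifts-step (Lifts-below j)

    Lifts-below : ∀ j → Lifts (below j) (lift-below j)
    Lifts-below zero a p = z≤n
    Lifts-below (suc j) = Lifts-B j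

  -- The lifts grow at most by the factor 2d per level: with K = e + 3,
  -- lift j + K ≤ 2^(D·(j+1)) for D = e + 1 + K.
  K : ℕ
  K = e + 3

  D : ℕ
  D = suc e + K

  lift-recurrence : ∀ c → d * (e + c + 2) + 1 + K ≤ 2 * d * (c + K)
  lift-recurrence c = begin
    d * (e + c + 2) + 1 + K   ≤⟨ +-monoˡ-≤ K (+-monoʳ-≤ (d * (e + c + 2)) (m^n>0 2 e)) ⟩
    d * (e + c + 2) + d + K   ≡⟨ cong (_+ K) (collect d e c) ⟩
    d * (c + K) + K           ≤⟨ +-monoʳ-≤ (d * (c + K)) (≤-trans (m≤n+m K c) (m≤n*m (c + K) d)) ⟩
    d * (c + K) + d * (c + K) ≡⟨ double d (c + K) ⟩
    2 * d * (c + K)           ∎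
    where
    open ≤-Reasoning
    collect : ∀ d e c → d * (e + c + 2) + d ≡ d * (c + (e + 3))
    collect = solve-∀
    double : ∀ d x → d * x + d * x ≡ 2 * d * x
    double = solve-∀

  mutual
    lift-bound : ∀ j → lift j + K ≤ 2 ^ (D * suc j)
    lift-bound j = begin
      lift j + K                      ≤⟨ lift-recurrence (lift-below j) ⟩
      2 ^ suc e * (lift-below j + K)  ≤⟨ *-monoʳ-≤ (2 ^ suc e) (lift-below-bound j) ⟩
      2 ^ suc e * 2 ^ (K + D * j)     ≡⟨ sym (^-distribˡ-+-* 2 (suc e) (K + D * j)) ⟩
      2 ^ (suc e + (K + D * j))       ≡⟨ cong (2 ^_) (trans (sym (+-assoc (suc e) K (D * j))) (sym (*-suc D j))) ⟩
      2 ^ (D * suc j)                 ∎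
      where open ≤-Reasoning

    lift-below-bound : ∀ j → lift-below j + K ≤ 2 ^ (K + D * j)
    lift-below-bound zero = ≤-trans (<⇒≤ (n<2^n K)) (^-monoʳ-≤ 2 (m≤m+n K (D * 0)))
    lift-below-bound (suc j) = ≤-trans (lift-bound j) (^-monoʳ-≤ 2 (m≤n+m (D * suc j) K))

module Terms {S : Set} {ar : S → ℕ} where

  lookup-substs : ∀ {n} (ts : Vec (Term ar) n) (σ : Subst) i → lookup (substs ts σ) i ≡ lookup ts i ⟪ σ ⟫
  lookup-substs (t ∷ ts) σ zero = refl
  lookup-substs (t ∷ ts) σ (suc i) = lookup-substs ts σ i

  lookup-embs : ∀ {n} (ts : Vec (Term ar) n) i → lookup (embs ts) i ≡ emb (lookup ts i)
  lookup-embs (t ∷ ts) zero = refl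
  lookup-embs (t ∷ ts) (suc i) = lookup-embs ts i

  embs-update : ∀ {n} (ts : Vec (Term ar) n) i t → embs (ts [ i ]≔ t) ≡ embs ts [ i ]≔ emb t
  embs-update (u ∷ ts) zero t = refl
  embs-update (u ∷ ts) (suc i) t = cong (emb u ∷_) (embs-update ts i t)

  mutual
    emb-subst : (t : Term ar) (σ : Subst) → emb (t ⟪ σ ⟫) ≡ emb t ⟪ emb ∘ σ ⟫
    emb-subst (var x) σ = refl
    emb-subst (fun f ts) σ = cong (fun (inj₁ f)) (embs-substs ts σ)

    embs-substs : ∀ {n} (ts : Vec (Term ar) n) (σ : Subst) → embs (substs ts σ) ≡ substs (embs ts) (emb ∘ σ)
    embs-substs [] σ = refl
    embs-substs (t ∷ ts) σ = cong₂ _∷_ (emb-subst t σ) (embs-substs ts σ)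

  mark-subst : ∀ f (ts : Vec (Term ar) (ar f)) (σ : Subst) → mark (fun f ts ⟪ σ ⟫) ≡ mark (fun f ts) ⟪ emb ∘ σ ⟫
  mark-subst f ts σ = cong (fun (inj₂ f)) (embs-substs ts σ)

  mutual
    emb-step : ∀ {R : List (Rule {ar = ar})} {s t} → Step (R ∈R) s t → Step (Emb R) (emb s) (emb t)
    emb-step (root {l} {r} mem σ) rewrite emb-subst l σ | emb-subst r σ = root (emb-rule mem) (emb ∘ σ)
    emb-step (arg {f} ts i st) = embs-step (inj₁ f) ts i st

    embs-step : ∀ {R : List (Rule {ar = ar})} h (ts : Vec (Term ar) (ar♯ ar h)) i {t} →
      Step (R ∈R) (lookup ts i) t → Step (Emb R) (fun h (embs ts)) (fun h (embs (ts [ i ]≔ t)))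
    embs-step {R} h ts i {t} st =
      subst (Step (Emb R) (fun h (embs ts))) (cong (fun h) (sym (embs-update ts i t)))
        (arg (embs ts) i (subst (λ u → Step (Emb R) u (emb t)) (sym (lookup-embs ts i)) (emb-step st)))

  mark-arg-step : ∀ {R : List (Rule {ar = ar})} f (ts : Vec (Term ar) (ar f)) i {t} →
    Step (R ∈R) (lookup ts i) t → Step (Emb R) (mark (fun f ts)) (mark (fun f (ts [ i ]≔ t)))
  mark-arg-step f = embs-step (inj₂ f)

  ⊴-trans : ∀ {a b c : Term ar} → a ⊴ b → b ⊴ c → a ⊴ c
  ⊴-trans p refl = p
  ⊴-trans p (arg i q) = arg i (⊴-trans p q)

  ⊴-subst : ∀ {u t : Term ar} (σ : Subst) → u ⊴ t → (u ⟪ σ ⟫) ⊴ (t ⟪ σ ⟫)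
  ⊴-subst σ refl = refl
  ⊴-subst σ (arg {ts = ts} i p) = arg i (subst (_ ⊴_) (sym (lookup-substs ts σ i)) (⊴-subst σ p))

  ⊴⇒Occurs : ∀ {x} {t : Term ar} → var x ⊴ t → Occurs x t
  ⊴⇒Occurs refl = here
  ⊴⇒Occurs (arg i p) = arg i (⊴⇒Occurs p)

  Occurs⇒⊴ : ∀ {x} {t : Term ar} (σ : Subst) → Occurs x t → σ x ⊴ (t ⟪ σ ⟫)
  Occurs⇒⊴ σ here = refl
  Occurs⇒⊴ σ (arg {ts = ts} i p) = arg i (subst (_ ⊴_) (sym (lookup-substs ts σ i)) (Occurs⇒⊴ σ p))

module Decidable {k : ℕ} {ar : Fin k → ℕ} where

  mutual
    _≟ᵀ_ : (s t : Term ar) → Dec (s ≡ t)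
    var x ≟ᵀ var y with x ≟ y
    ... | yes refl = yes refl
    ... | no x≢y = no λ { refl → x≢y refl }
    var x ≟ᵀ fun g ts = no λ ()
    fun f ss ≟ᵀ var y = no λ ()
    fun f ss ≟ᵀ fun g ts with f Fin.≟ g
    ... | no f≢g = no λ { refl → f≢g refl }
    ... | yes refl with ss ≟ⱽ ts
    ...   | yes refl = yes refl
    ...   | no ss≢ts = no λ { refl → ss≢ts refl }

    _≟ⱽ_ : ∀ {n} (ss ts : Vec (Term ar) n) → Dec (ss ≡ ts)
    [] ≟ⱽ [] = yes refl
    (s ∷ ss) ≟ⱽ (t ∷ ts) with s ≟ᵀ t | ss ≟ⱽ ts
    ... | yes refl | yes refl = yes refl
    ... | no s≢t | _ = no λ { refl → s≢t refl }
    ... | yes _ | no ss≢ts = no λ { refl → ss≢ts refl }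

  mutual
    _⊴?_ : (u t : Term ar) → Dec (u ⊴ t)
    u ⊴? t with u ≟ᵀ t
    ... | yes refl = yes refl
    u ⊴? var y | no u≢t = no λ { refl → u≢t refl }
    u ⊴? fun f ts | no u≢t with u ⊴?-some ts
    ... | yes (i , p) = yes (arg i p)
    ... | no none = no λ { refl → u≢t refl ; (arg i p) → none (i , p) }

    _⊴?-some_ : ∀ {n} (u : Term ar) (ts : Vec (Term ar) n) → Dec (∃ λ i → u ⊴ lookup ts i)
    u ⊴?-some [] = no λ { (() , _) }
    u ⊴?-some (t ∷ ts) with u ⊴? t | u ⊴?-some ts
    ... | yes p | _ = yes (zero , p)
    ... | no _ | yes (i , p) = yes (suc i , p)
    ... | no ¬p | no none = no λ { (zero , p) → ¬p p ; (suc i , p) → none (i , p) }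

  _◁?_ : (u t : Term ar) → Dec (u ◁ t)
  u ◁? var y = no λ ()
  u ◁? fun f ts = Dec.map′ (λ (i , p) → arg i p) (λ { (arg i p) → i , p }) (u ⊴?-some ts)

  RootIs? : (g : Fin k) (l : Term ar) → Dec (RootIs g l)
  RootIs? g (var x) = no λ ()
  RootIs? g (fun f ls) with f Fin.≟ g
  ... | yes refl = yes (root ls)
  ... | no f≢g = no λ { (root _) → f≢g refl }

  Defined? : (R : List (Rule {ar = ar})) (g : Fin k) → Dec (Defined R g)
  Defined? R g = Dec.map′ find (λ (ρ , mem , p) → lose mem p) (any? (RootIs? g ∘ proj₁) R)

module Weights {k : ℕ} {ar : Fin k → ℕ} (R : List (Rule {ar = ar})) (wf : IsTRS R) (e : ℕ)
  (ar≤d : ∀ f → ar f ≤ 2 ^ e) (rhs≤d : ∀ {l r} → (l , r) ∈ R → size r ≤ 2 ^ e) where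

  open Hierarchy e
  open Terms {ar = ar}
  open Decidable {ar = ar}

  Node : (f : Fin k) → Vec (Term ar) (ar f) → ℕ → ℕ → Set
  Node f ts x v = (¬ Defined R f × x < v) ⊎ (∃ λ j → DhLe (DP/R R) (mark (fun f ts)) j × B j x ≤ v)

  data Weight : Term ar → ℕ → Set where
    var : ∀ {x v} → Weight (var x) v
    fun : ∀ {f ts v} (vs : Vec ℕ (ar f)) → (∀ i → Weight (lookup ts i) (lookup vs i)) →
          Node f ts (sum vs) v → Weight (fun f ts) v

  node-> : ∀ {f ts x v} → Node f ts x v → x < v
  node-> (inj₁ (_ , x<v)) = x<v
  node-> (inj₂ (j , _ , B≤v)) = <-≤-trans (step-infl (below j) _) B≤v

  Weight-sub : ∀ {s u v} → Weight s v → u ⊴ s → ∃ λ w → w ≤ v × Weight u w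
  Weight-sub {v = v} w refl = v , ≤-refl , w
  Weight-sub (fun vs ws nd) (arg i p) with Weight-sub (ws i) p
  ... | w , w≤ , wu = w , ≤-trans w≤ (≤-trans (lookup≤sum vs i) (<⇒≤ (node-> nd))) , wu

  constructor-node : ∀ G {g} {ts : Vec (Term ar) (ar g)} {x Y} → ¬ Defined R g → x ≤ d * Y →
    ∃ λ w → w ≤ ψ G Y × Node g ts x w
  constructor-node G {Y = Y} undefined x≤dY =
    _ , s≤s (≤-trans x≤dY (m≤n+m (d * Y) (G (d * Y)))) , inj₁ (undefined , ≤-refl)

  dp-successor-node : ∀ {s g} {ts : Vec (Term ar) (ar g)} j {x Y} →
    DP/R R s (mark (fun g ts)) → DhLe (DP/R R) s j → x ≤ d * Y →
    ∃ λ w → w ≤ ψ (below j) Y × Node g ts x w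
  dp-successor-node zero st dh _ = ⊥-elim (DhLe-nonzero st dh)
  dp-successor-node (suc h) st dh x≤dY =
    B h _ , ≤-trans (B-mono h x≤dY) (≤-trans (m≤m+n _ _) (n≤1+n _)) , inj₂ (h , DhLe-step st dh , ≤-refl)

  -- Every subterm u of r gets a weight below ψ^|u|(A), hence rσ weighs less
  -- than B j A.
  module RootStep {g : Fin k} {ls : Vec (Term ar) (ar g)} {r : Term ar} (mem : (fun g ls , r) ∈ R)
    (σ : Subst) (vs : Vec ℕ (ar g)) (ws : ∀ i → Weight (lookup (substs ls σ) i) (lookup vs i))
    (j : ℕ) (dh : DhLe (DP/R R) (mark (fun g (substs ls σ))) j) where

    l : Term ar
    l = fun g ls

    A : ℕ
    A = sum vs

    ψj : ℕ → ℕ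
    ψj = ψ (below j)

    fold-ψj-more : ∀ {n n'} → n ≤ n' → fold A ψj n ≤ fold A ψj n'
    fold-ψj-more = fold-more (ψ-mono (below-mono j)) (ψ-infl (below j)) A

    old-subterm-weight : ∀ n i {s} → s ⊴ (lookup ls i ⟪ σ ⟫) → ∃ λ w → w ≤ fold A ψj n × Weight s w
    old-subterm-weight n i {s} p with Weight-sub (ws i) (subst (s ⊴_) (sym (lookup-substs ls σ i)) p)
    ... | w , w≤ , wt = w , ≤-trans w≤ (≤-trans (lookup≤sum vs i) (fold-infl n (ψ-infl (below j)) A)) , wt

    dp-step : ∀ {g'} {us : Vec (Term ar) (ar g')} → fun g' us ⊴ r → ¬ (fun g' us ◁ l) → Defined R g' →
      DP/R R (mark (fun g (substs ls σ))) (mark (fun g' (substs us σ)))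
    dp-step {g'} {us} p ¬◁ def = relative-single
      (subst₂ (Step (DP R)) (sym (mark-subst g ls σ)) (sym (mark-subst g' us σ))
        (root (dp mem p (root us) def ¬◁) (emb ∘ σ)))

    mutual
      rhs-weight : ∀ u → u ⊴ r → ∃ λ w → w ≤ fold A ψj (size u) × Weight (u ⟪ σ ⟫) w
      rhs-weight (var x) p with proj₂ (All.lookup wf mem) x (⊴⇒Occurs p)
      ... | arg i o = old-subterm-weight 1 i (Occurs⇒⊴ σ o)
      rhs-weight (fun g' us) p with fun g' us ◁? l
      ... | yes (arg i q) = old-subterm-weight (size (fun g' us)) i (⊴-subst σ q)
      ... | no ¬◁ = new-node-weight us p ¬◁

      new-node-weight : ∀ {g'} (us : Vec (Term ar) (ar g')) → fun g' us ⊴ r → ¬ (fun g' us ◁ l) →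
        ∃ λ w → w ≤ fold A ψj (size (fun g' us)) × Weight (fun g' us ⟪ σ ⟫) w
      new-node-weight {g'} us p ¬◁ with rhs-weights us (λ i → ⊴-trans (arg i refl) p)
      ... | vs' , vs'≤ , ws' = let w , w≤ , nd = node-weight in w , w≤ , fun vs' ws' nd
        where
        args≤ : sum vs' ≤ d * fold A ψj (sizes us)
        args≤ = ≤-trans (sum-bound vs' vs'≤) (*-monoˡ-≤ _ (ar≤d g'))
        node-weight : ∃ λ w → w ≤ ψj (fold A ψj (sizes us)) × Node g' (substs us σ) (sum vs') w
        node-weight with Defined? R g'
        ... | yes def = dp-successor-node j (dp-step p ¬◁ def) dh args≤
        ... | no undefined = constructor-node (below j) undefined args≤

      rhs-weights : ∀ {n} (us : Vec (Term ar) n) → (∀ i → lookup us i ⊴ r) →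
        Σ (Vec ℕ n) λ vs' → (∀ i → lookup vs' i ≤ fold A ψj (sizes us)) ×
                            (∀ i → Weight (lookup (substs us σ) i) (lookup vs' i))
      rhs-weights [] p = [] , (λ ()) , (λ ())
      rhs-weights (t ∷ us) p with rhs-weight t (p zero) | rhs-weights us (p ∘ suc)
      ... | w , w≤ , wt | vs' , vs'≤ , ws' =
        w ∷ vs' ,
        (λ { zero → ≤-trans w≤ (fold-ψj-more (m≤m+n (size t) (sizes us)))
           ; (suc i) → ≤-trans (vs'≤ i) (fold-ψj-more (m≤n+m (sizes us) (size t))) }) ,
        (λ { zero → wt ; (suc i) → ws' i })

    contractum-weight : ∃ λ w → w < B j A × Weight (r ⟪ σ ⟫) w
    contractum-weight with rhs-weight r refl
    ... | w , w≤ , wr = w , s≤s (≤-trans w≤ (fold-ψj-more (rhs≤d mem))) , wr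

  -- Root steps decrease weights.  A constructor node cannot be a redex.
  root-decrease : ∀ {l r v} → (l , r) ∈ R → (σ : Subst) → Weight (l ⟪ σ ⟫) v →
    ∃ λ v' → v' < v × Weight (r ⟪ σ ⟫) v'
  root-decrease {var x} mem σ w with All.lookup wf mem
  ... | (_ , ()) , _
  root-decrease {fun g ls} mem σ (fun vs ws (inj₁ (undefined , _))) = ⊥-elim (undefined (_ , mem , root ls))
  root-decrease {fun g ls} mem σ (fun vs ws (inj₂ (j , dh , B≤v))) with RootStep.contractum-weight mem σ vs ws j dh
  ... | w , w<B , wr = w , <-≤-trans w<B B≤v , wr

  -- Steps in an argument decrease the argument sum; the node weight then
  -- decreases by monotonicity of B j, and the DP(R)/R-height of the marked
  -- node does not grow.
  node-step : ∀ {f ts i t x x' v} → Step (R ∈R) (lookup ts i) t → x' < x → Node f ts x v →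
    ∃ λ v' → v' < v × Node f (ts [ i ]≔ t) x' v'
  node-step st x'<x (inj₁ (undefined , x<v)) = suc _ , ≤-trans (s≤s x'<x) x<v , inj₁ (undefined , ≤-refl)
  node-step {f} {ts} {i} st x'<x (inj₂ (j , dh , B≤v)) =
    B j _ , <-≤-trans (B-smono j x'<x) B≤v , inj₂ (j , DhLe-relative-prepend (mark-arg-step f ts i st) dh , ≤-refl)

  args-update : ∀ {n} (ts : Vec (Term ar) n) (vs : Vec ℕ n) i {t v'} →
    (∀ i → Weight (lookup ts i) (lookup vs i)) → Weight t v' →
    ∀ i' → Weight (lookup (ts [ i ]≔ t) i') (lookup (vs [ i ]≔ v') i')
  args-update ts vs i {t} {v'} ws wt i' with i' Fin.≟ i
  ... | yes refl rewrite lookup∘update i ts t | lookup∘update i vs v' = wt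
  ... | no i'≢i rewrite lookup∘update′ i'≢i ts t | lookup∘update′ i'≢i vs v' = ws i'

  decrease : ∀ {s t v} → Step (R ∈R) s t → Weight s v → ∃ λ v' → v' < v × Weight t v'
  decrease (root mem σ) w = root-decrease mem σ w
  decrease (arg ts i st) (fun vs ws nd) with decrease st (ws i)
  ... | v' , v'<v , wt =
    let u , u<v , nd' = node-step st (sum-update-< vs i v'<v) nd
    in u , u<v , fun (vs [ i ]≔ v') (args-update ts vs i ws wt) nd'

  weight-bounds-dh : ∀ {s v} → Weight s v → DhLe (Step (R ∈R)) s v
  weight-bounds-dh = rank-bounds-dh Weight decrease

  -- Initial weights: if all marked terms of size ≤ n have height ≤ m, each
  -- node raises the level of the double exponential by at most C.
  module Initial (n m : ℕ) (H : ∀ (t : Term ar) → size t ≤ n → DhLe (DP/R R) (mark t) m) where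

    C : ℕ
    C = lift m + K

    node-level : ∀ S → S * C + e + lift m < C + S * C
    node-level S = ≤-trans (m≤m+n _ 2) (≤-reflexive (regroup S e (lift m)))
      where
      regroup : ∀ S e L → suc (S * (L + (e + 3)) + e + L) + 2 ≡ L + (e + 3) + S * (L + (e + 3))
      regroup = solve-∀

    mutual
      initial-weight : ∀ s → size s ≤ n → Weight s (Φ (size s * C))
      initial-weight (var x) _ = var
      initial-weight (fun f ts) |s|≤n with initial-weights ts (≤-trans (n≤1+n _) |s|≤n)
      ... | vs , ws , vs≤ = fun vs ws node
        where
        S = sizes ts
        args≤ : sum vs ≤ Φ (S * C + e)
        args≤ = ≤-trans (sum-bound vs vs≤) (≤-trans (*-monoˡ-≤ _ (ar≤d f)) (Φ-2^ e (S * C) ≤-refl))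
        node : Node f ts (sum vs) (Φ (size (fun f ts) * C))
        node with Defined? R f
        ... | yes _ = inj₂ (m , H (fun f ts) |s|≤n ,
                ≤-trans (Lifts-B m (S * C + e) args≤) (Φ-mono (<⇒≤ (node-level S))))
        ... | no undefined = inj₁ (undefined ,
                ≤-trans (Φ-suc-≤ (S * C + e) args≤) (Φ-mono (≤-trans (s≤s (m≤m+n (S * C + e) (lift m))) (node-level S))))

      initial-weights : ∀ {p} (ts : Vec (Term ar) p) → sizes ts ≤ n →
        Σ (Vec ℕ p) λ vs → (∀ i → Weight (lookup ts i) (lookup vs i)) × (∀ i → lookup vs i ≤ Φ (sizes ts * C))
      initial-weights [] _ = [] , (λ ()) , (λ ())
      initial-weights (t ∷ ts) ≤n with initial-weight t (≤-trans (m≤m+n _ _) ≤n) | initial-weights ts (≤-trans (m≤n+m _ _) ≤n)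
      ... | wt | vs , ws , vs≤ =
        Φ (size t * C) ∷ vs , (λ { zero → wt ; (suc i) → ws i }) ,
        (λ { zero → Φ-mono (*-monoˡ-≤ C (m≤m+n (size t) (sizes ts)))
           ; (suc i) → ≤-trans (vs≤ i) (Φ-mono (*-monoˡ-≤ C (m≤n+m (sizes ts) (size t)))) })

theorem5p12 : ∀ {k : ℕ} (ar : Fin k → ℕ) (R : List (Rule {ar = ar})) →
    IsTRS R → Terminating R →
    ∃[ D ] ∀ (n m : ℕ) →
      (∀ (t : Term ar) → size t ≤ n → DhLe (DP/R R) (mark t) m) →
      ∀ (t : Term ar) → size t ≤ n →
        DhLe (Step (R ∈R)) t (2 ^ (2 ^ (n * 2 ^ (D * (m + 1)))))
theorem5p12 ar R wf _ = D , λ n m H t |t|≤n →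
  DhLe-weaken (weight-bounds-dh (Initial.initial-weight n m H t |t|≤n))
    (Φ-mono (*-mono-≤ |t|≤n (subst (λ j → lift m + K ≤ 2 ^ (D * j)) (+-comm 1 m) (lift-bound m))))
  where
  arity-bound : ∃ λ b → ∀ f → ar f ≤ b
  arity-bound = Fin-bounded ar
  rhs-bound : ∃ λ b → ∀ {ρ} → ρ ∈ R → size (proj₂ ρ) ≤ b
  rhs-bound = List-bounded (size ∘ proj₂) R
  e : ℕ
  e = proj₁ arity-bound + proj₁ rhs-bound
  below-2^e : ∀ {x b} → x ≤ b → b ≤ e → x ≤ 2 ^ e
  below-2^e x≤b b≤e = ≤-trans x≤b (≤-trans b≤e (<⇒≤ (n<2^n e)))
  open Hierarchy e using (D; K; lift; lift-bound)
  open Weights R wf e (λ f → below-2^e (proj₂ arity-bound f) (m≤m+n _ _))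
                      (λ mem → below-2^e (proj₂ rhs-bound mem) (m≤n+m _ _))
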